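{- Let $k$ be a positive real number and let $P$ be a $k$-Eulerian poset of rank $n+1$. Then (1) every interval $[x,y]$ of $P$ (viewed as a graded poset) is $k$-Eulerian; and (2) $\displaystyle\sum_{i=1}^n(-1)^{i-1}f_i(P)=k\bigl(1-(-1)^n\bigr)$.
   Context: A graded poset is a finite poset $P$ with a unique minimum $\hat 0$, a unique maximum $\hat 1$, and a rank function $\rho$ with $\rho(\hat 0)=0$ and $\rho(y)-\rho(x)=1$ whenever $y$ covers $x$; the rank of $P$ is $\rho(\hat 1)$, and $\rho(x,y)=\rho(y)-\rho(x)$. $f_i(P)$ is the number of elements of $P$ of rank $i$. The $k$-Möbius function is defined on intervals by $\mu_k([x,x])=1$ and, for $x<y$, $\mu_k([x,y])=-1-\frac1k\sum_{x<z<y}\mu_k([x,z])$. A graded poset is $k$-Eulerian if $\mu_k([x,y])=(-1)^{\rho(x,y)}$ for every interval $[x,y]\subseteq P$. -}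

module Defs where

open import Level using (Level)
open import Data.Bool using (Bool; true; false; T)
open import Data.Unit using (tt)
open import Data.Empty using (⊥; ⊥-elim)
open import Data.Nat using (ℕ; zero; suc)
open import Data.Integer as ℤ using (ℤ; +_; ∣_∣)
open import Data.Integer.Properties using (+-assoc; +-comm)
open import Data.List using (List; []; _∷_; length; filter; map)
open import Data.List.Relation.Unary.All as All using (All; []; _∷_)
open import Data.List.Relation.Unary.Any using (here; there)
open import Data.List.Relation.Unary.AllPairs using ([]; _∷_)
open import Data.List.Relation.Unary.Unique.Propositional using (Unique)
open import Data.List.Membership.Propositional using (_∈_)
open import Data.Product using (Σ; _×_; _,_; proj₁; proj₂)
open import Relation.Nullary using (¬_; Dec; yes; no)
open import Relation.Nullary.Decidable using (T?; _×-dec_; ¬?)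
open import Relation.Binary.Definitions using (DecidableEquality)
open import Relation.Binary.PropositionalEquality
  using (_≡_; _≢_; refl; cong; sym; trans)
open import Algebra.Bundles using (CommutativeRing)

-- The rank function is taken ℤ-valued (its values
-- are automatically ≥ 0, being ranks along chains from the minimum).

record GradedPoset : Set₁ where
  field
    Carrier     : Set
    _≟_         : DecidableEquality Carrier
    _≤ᵇ_        : Carrier → Carrier → Bool
    elements    : List Carrier
    complete    : ∀ x → x ∈ elements
    unique      : Unique elements
    ≤-refl      : ∀ x → T (x ≤ᵇ x)
    ≤-antisym   : ∀ x y → T (x ≤ᵇ y) → T (y ≤ᵇ x) → x ≡ y
    ≤-trans     : ∀ x y z → T (x ≤ᵇ y) → T (y ≤ᵇ z) → T (x ≤ᵇ z)
    bot         : Carrier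
    top         : Carrier
    bot-least   : ∀ x → T (bot ≤ᵇ x)
    top-greatest : ∀ x → T (x ≤ᵇ top)
    rank        : Carrier → ℤ
    rank-bot    : rank bot ≡ + 0
    rank-cover  : ∀ x y → T (x ≤ᵇ y) → x ≢ y →
                  (∀ z → T (x ≤ᵇ z) → x ≢ z → T (z ≤ᵇ y) → z ≢ y → ⊥) →
                  rank y ≡ rank x ℤ.+ + 1

  _<_ : Carrier → Carrier → Set
  x < y = T (x ≤ᵇ y) × x ≢ y

  _<?_ : ∀ x y → Dec (x < y)
  x <? y = T? (x ≤ᵇ y) ×-dec ¬? (x ≟ y)

  between : Carrier → Carrier → List Carrier
  between x y = filter (λ z → (x <? z) ×-dec (z <? y)) elements

  f : ℕ → ℕ
  f i = length (filter (λ z → rank z ℤ.≟ + i) elements)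

open GradedPoset public

private
  T-irr : (b : Bool) (p q : T b) → p ≡ q
  T-irr true tt tt = refl

module IntervalConstruction (P : GradedPoset) (x y : Carrier P)
                            (x≤y : T (_≤ᵇ_ P x y)) where
  open GradedPoset P using () renaming (_≤ᵇ_ to _≤_; _≟_ to _≟P_)

  I : Set
  I = Σ (Carrier P) (λ z → T (x ≤ z) × T (z ≤ y))

  I-ext : (a b : I) → proj₁ a ≡ proj₁ b → a ≡ b
  I-ext (z , p , q) (.z , p' , q') refl
    rewrite T-irr _ p p' | T-irr _ q q' = refl

  _≟I_ : DecidableEquality I
  a ≟I b with proj₁ a ≟P proj₁ b
  ... | yes e = yes (I-ext a b e)
  ... | no ne = no (λ e → ne (cong proj₁ e))

  sub : List (Carrier P) → List I
  sub [] = []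
  sub (z ∷ zs) with T? (x ≤ z) | T? (z ≤ y)
  ... | yes p | yes q = (z , p , q) ∷ sub zs
  ... | yes _ | no _  = sub zs
  ... | no _  | _     = sub zs

  sub-complete : (w : I) (zs : List (Carrier P)) → proj₁ w ∈ zs → w ∈ sub zs
  sub-complete w (z ∷ zs) (here e) with T? (x ≤ z) | T? (z ≤ y)
  ... | yes p | yes q = here (I-ext w (z , p , q) e)
  ... | yes _ | no nq = ⊥-elim (nq (Relation.Binary.PropositionalEquality.subst (λ u → T (u ≤ y)) e (proj₂ (proj₂ w))))
  ... | no np | _     = ⊥-elim (np (Relation.Binary.PropositionalEquality.subst (λ u → T (x ≤ u)) e (proj₁ (proj₂ w))))
  sub-complete w (z ∷ zs) (there m) with T? (x ≤ z) | T? (z ≤ y)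
  ... | yes p | yes q = there (sub-complete w zs m)
  ... | yes _ | no _  = sub-complete w zs m
  ... | no _  | _     = sub-complete w zs m

  All-sub : {Q : Carrier P → Set} (zs : List (Carrier P)) →
            All Q zs → All (λ w → Q (proj₁ w)) (sub zs)
  All-sub [] [] = []
  All-sub (z ∷ zs) (qz ∷ qs) with T? (x ≤ z) | T? (z ≤ y)
  ... | yes p | yes q = qz ∷ All-sub zs qs
  ... | yes _ | no _  = All-sub zs qs
  ... | no _  | _     = All-sub zs qs

  sub-unique : (zs : List (Carrier P)) → Unique zs → Unique (sub zs)
  sub-unique [] [] = []
  sub-unique (z ∷ zs) (h ∷ u) with T? (x ≤ z) | T? (z ≤ y)
  ... | yes p | yes q =
        All.map (λ ne e → ne (cong proj₁ e)) (All-sub zs h) ∷ sub-unique zs u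
  ... | yes _ | no _  = sub-unique zs u
  ... | no _  | _     = sub-unique zs u

  rankI : I → ℤ
  rankI w = rank P (proj₁ w) ℤ.- rank P x

  shift : ∀ a b c → b ≡ a ℤ.+ + 1 → b ℤ.- c ≡ (a ℤ.- c) ℤ.+ + 1
  shift a b c refl = trans (+-assoc a (+ 1) (ℤ.- c))
                     (trans (cong (λ t → a ℤ.+ t) (+-comm (+ 1) (ℤ.- c)))
                            (sym (+-assoc a (ℤ.- c) (+ 1))))

  interval : GradedPoset
  interval = record
    { Carrier = I
    ; _≟_ = _≟I_
    ; _≤ᵇ_ = λ a b → proj₁ a ≤ proj₁ b
    ; elements = sub (elements P)
    ; complete = λ w → sub-complete w (elements P) (complete P (proj₁ w))
    ; unique = sub-unique (elements P) (unique P)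
    ; ≤-refl = λ a → ≤-refl P (proj₁ a)
    ; ≤-antisym = λ a b p q → I-ext a b (≤-antisym P _ _ p q)
    ; ≤-trans = λ a b c → ≤-trans P (proj₁ a) (proj₁ b) (proj₁ c)
    ; bot = x , ≤-refl P x , x≤y
    ; top = y , x≤y , ≤-refl P y
    ; bot-least = λ a → proj₁ (proj₂ a)
    ; top-greatest = λ a → proj₂ (proj₂ a)
    ; rank = rankI
    ; rank-bot = Data.Integer.Properties.+-inverseʳ (rank P x)
    ; rank-cover = λ a b a≤b a≢b nobetween →
        shift (rank P (proj₁ a)) (rank P (proj₁ b)) (rank P x)
          (rank-cover P (proj₁ a) (proj₁ b) a≤b
            (λ e → a≢b (I-ext a b e))
            (λ z a≤z a≢z z≤b z≢b →
               nobetween (z , ≤-trans P x (proj₁ a) z (proj₁ (proj₂ a)) a≤z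
                            , ≤-trans P z (proj₁ b) y z≤b (proj₂ (proj₂ b)))
                 a≤z (λ e → a≢z (cong proj₁ e))
                 z≤b (λ e → z≢b (cong proj₁ e))))
    }

interval : (P : GradedPoset) (x y : Carrier P) → T (_≤ᵇ_ P x y) → GradedPoset
interval P x y x≤y = IntervalConstruction.interval P x y x≤y

-- Scalars: the parameter k is an invertible element of a commutative
-- ring R (with kinv = 1/k).  The real numbers with k > 0 are an instance.

module _ {c ℓ : Level} (R : CommutativeRing c ℓ) where
  open CommutativeRing R hiding (Carrier)
  open CommutativeRing R using () renaming (Carrier to S)

  sgn : ℕ → S
  sgn zero = 1#
  sgn (suc n) = - sgn n

  natR : ℕ → S
  natR zero = 0#
  natR (suc n) = 1# + natR n

  sumR : List S → S
  sumR [] = 0#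
  sumR (a ∷ as) = a + sumR as

  altSum : GradedPoset → ℕ → S
  altSum P zero = 0#
  altSum P (suc n) = altSum P n + sgn n * natR (f P (suc n))

  module _ (kinv : S) (P : GradedPoset) where
    -- Any strict chain in P has at most |P| elements, so the budget
    -- |P| (used in μk below) is never exhausted.
    mu : ℕ → GradedPoset.Carrier P → GradedPoset.Carrier P → S
    mu zero x y = 1#
    mu (suc d) x y with GradedPoset._≟_ P x y
    ... | yes _ = 1#
    ... | no _  = - 1# - kinv * sumR (map (mu d x) (between P x y))

    μk : GradedPoset.Carrier P → GradedPoset.Carrier P → S
    μk x y = mu (length (elements P)) x y

    IsKEulerian : Set ℓ
    IsKEulerian = ∀ x y → T (_≤ᵇ_ P x y) →
                  μk x y ≈ sgn ∣ rank P y ℤ.- rank P x ∣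

-- The recursion defining μ_k on [a,b] only sees the elements strictly between a and b.
-- These are the same whether computed in P or in an interval of P containing a and b,
-- and ranks in the interval are ranks in P shifted by a constant; this gives (1).
-- For (2): ranks increase strictly along a < b (split at intermediate elements until
-- only covers remain), so the elements strictly between 0̂ and 1̂ are exactly those of
-- rank 1,…,n.
-- Unfolding μ_k(0̂,1̂) = (-1)^(n+1) with μ_k(0̂,z) = (-1)^ρ(z) therefore gives
-- (-1)^(n+1) = -1 + (1/k) Σ_{i=1}^n (-1)^(i-1) f_i, which rearranges to the identity.
-- Since μk is computed with a recursion budget, any budget exceeding the number of
-- elements strictly between a and b has to be shown to give the same value.
module Submission where

open import Defs
open import Level using (Level)
open import Function using (_∘_; _⇔_; mk⇔; Equivalence)
open import Data.Bool using (T)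
open import Data.Empty using (⊥-elim)
open import Data.Nat as ℕ using (ℕ; zero; suc; s≤s)
import Data.Nat.Properties as ℕ
open import Data.Nat.Induction using (<-wellFounded)
open import Induction.WellFounded using (Acc; acc)
open import Data.Integer as ℤ using (ℤ; +_; ∣_∣)
import Data.Integer.Properties as ℤ
open import Data.Integer.Solver using (module +-*-Solver)
open import Data.Sum using (inj₁; inj₂)
open import Data.Product using (_×_; _,_; proj₁; proj₂; ∃-syntax)
open import Data.List using (List; []; _∷_; [_]; length; filter; map)
open import Data.List.Properties using
  (filter-accept; filter-reject; filter-notAll; filter-≐; filter-++; length-++; length-map; map-∘)
open import Data.List.Relation.Unary.All as All using (All; []; _∷_)
open import Data.List.Relation.Unary.All.Properties using (all-filter)
open import Data.List.Relation.Unary.Any as Any using (any?)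
open import Data.List.Membership.Propositional using (_∈_; lose)
open import Data.List.Membership.Propositional.Properties using (∈-filter⁺)
open import Relation.Nullary using (¬_; Dec; yes; no)
open import Relation.Nullary.Decidable using (T?; _×-dec_; map′)
open import Relation.Unary using (Pred; Decidable)
open import Relation.Binary.PropositionalEquality
  using (_≡_; _≢_; refl; sym; trans; cong; subst; module ≡-Reasoning)
open import Algebra.Bundles using (CommutativeRing)
import Algebra.Properties.Ring as RingProperties
import Algebra.Properties.CommutativeSemigroup as CommutativeSemigroupProperties
import Relation.Binary.Reasoning.Setoid as SetoidReasoning

module _ {a p q} {A : Set a} {P : Pred A p} {Q : Pred A q}
         (P? : Decidable P) (Q? : Decidable Q) where

  filter-absorbs : (∀ {x} → P x → Q x) → ∀ xs → filter P? (filter Q? xs) ≡ filter P? xs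
  filter-absorbs P⇒Q [] = refl
  filter-absorbs P⇒Q (x ∷ xs) with Q? x
  ... | no ¬Qx = trans (filter-absorbs P⇒Q xs) (sym (filter-reject P? (¬Qx ∘ P⇒Q)))
  ... | yes _ with P? x
  ...   | yes _ = cong (x ∷_) (filter-absorbs P⇒Q xs)
  ...   | no _  = filter-absorbs P⇒Q xs

  length-filter-< : (∀ {x} → P x → Q x) → ∀ {w xs} → w ∈ xs → Q w → ¬ P w →
                    length (filter P? xs) ℕ.< length (filter Q? xs)
  length-filter-< P⇒Q {xs = xs} w∈xs Qw ¬Pw =
    subst (ℕ._< length (filter Q? xs)) (cong length (filter-absorbs P⇒Q xs))
      (filter-notAll P? (filter Q? xs) (lose (∈-filter⁺ Q? w∈xs Qw) ¬Pw))

map-filter : ∀ {a b p} {A : Set a} {B : Set b} {P : Pred B p}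
             (f : A → B) (P? : Decidable P) (xs : List A) →
             map f (filter (P? ∘ f) xs) ≡ filter P? (map f xs)
map-filter f P? [] = refl
map-filter f P? (x ∷ xs) with P? (f x)
... | yes _ = cong (f x ∷_) (map-filter f P? xs)
... | no _  = map-filter f P? xs

module GradedPosetProperties (Q : GradedPoset) where
  private module Q = GradedPoset Q

  StrictlyBetween : Carrier Q → Carrier Q → Pred (Carrier Q) _
  StrictlyBetween a b z = a Q.< z × z Q.< b

  strictlyBetween? : ∀ a b → Decidable (StrictlyBetween a b)
  strictlyBetween? a b z = (a Q.<? z) ×-dec (z Q.<? b)

  ∃strictlyBetween? : ∀ a b → Dec (∃[ z ] StrictlyBetween a b z)
  ∃strictlyBetween? a b =
    map′ Any.satisfied (λ (z , h) → lose (Q.complete z) h)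
      (any? (strictlyBetween? a b) Q.elements)

  <-transˡ : ∀ {a b c} → a Q.< b → T (b Q.≤ᵇ c) → a Q.< c
  <-transˡ {a} {b} {c} (a≤b , a≢b) b≤c =
    Q.≤-trans a b c a≤b b≤c , λ { refl → a≢b (Q.≤-antisym a b a≤b b≤c) }

  <-transʳ : ∀ {a b c} → T (a Q.≤ᵇ b) → b Q.< c → a Q.< c
  <-transʳ {a} {b} {c} a≤b (b≤c , b≢c) =
    Q.≤-trans a b c a≤b b≤c , λ { refl → b≢c (Q.≤-antisym b a b≤c a≤b) }

  length-between-<ˡ : ∀ {a z b} → a Q.< z → z Q.< b →
                      length (Q.between a z) ℕ.< length (Q.between a b)
  length-between-<ˡ {a} {z} {b} a<z z<b =
    length-filter-< (strictlyBetween? a z) (strictlyBetween? a b)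
      (λ (a<w , w<z) → a<w , <-transˡ w<z (proj₁ z<b))
      (Q.complete z) (a<z , z<b) (λ (_ , z<z) → proj₂ z<z refl)

  length-between-<ʳ : ∀ {a z b} → a Q.< z → z Q.< b →
                      length (Q.between z b) ℕ.< length (Q.between a b)
  length-between-<ʳ {a} {z} {b} a<z z<b =
    length-filter-< (strictlyBetween? z b) (strictlyBetween? a b)
      (λ (z<w , w<b) → <-transʳ (proj₁ a<z) z<w , w<b)
      (Q.complete z) (a<z , z<b) (λ (z<z , _) → proj₂ z<z refl)

  length-between-< : ∀ a b → length (Q.between a b) ℕ.< length Q.elements
  length-between-< a b =
    filter-notAll (strictlyBetween? a b) Q.elements
      (lose (Q.complete a) (λ (a<a , _) → proj₂ a<a refl))

  rank-increasing : ∀ {a b} → a Q.< b → ∃[ j ] Q.rank b ≡ Q.rank a ℤ.+ + suc j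
  rank-increasing {a} {b} = go a b (<-wellFounded (length (Q.between a b)))
    where
    go : ∀ a b → Acc ℕ._<_ (length (Q.between a b)) → a Q.< b →
         ∃[ j ] Q.rank b ≡ Q.rank a ℤ.+ + suc j
    go a b (acc rec) (a≤b , a≢b) with ∃strictlyBetween? a b
    ... | no ∄z = 0 , Q.rank-cover a b a≤b a≢b
                        (λ z a≤z a≢z z≤b z≢b → ∄z (z , (a≤z , a≢z) , (z≤b , z≢b)))
    ... | yes (z , a<z , z<b)
      with go a z (rec (length-between-<ˡ a<z z<b)) a<z
         | go z b (rec (length-between-<ʳ a<z z<b)) z<b
    ... | i , ρz | j , ρb =
      i ℕ.+ suc j ,
      trans ρb (trans (cong (ℤ._+ + suc j) ρz) (ℤ.+-assoc (Q.rank a) (+ suc i) (+ suc j)))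

module RingSums {c ℓ} (R : CommutativeRing c ℓ) where
  open CommutativeRing R
    renaming (Carrier to S; refl to ≈-refl; sym to ≈-sym; trans to ≈-trans)
  open RingProperties ring using (-‿distribʳ-*; -‿involutive; -‿+-comm; -0#≈0#)
  open CommutativeSemigroupProperties +-commutativeSemigroup using (interchange)
  open SetoidReasoning setoid

  sumR-cong : ∀ {A : Set} {g h : A → S} {xs : List A} →
              All (λ z → g z ≈ h z) xs → sumR R (map g xs) ≈ sumR R (map h xs)
  sumR-cong []       = ≈-refl
  sumR-cong (e ∷ es) = +-cong e (sumR-cong es)

  natR-+ : ∀ m n → natR R (m ℕ.+ n) ≈ natR R m + natR R n
  natR-+ zero    n = ≈-sym (+-identityˡ _)
  natR-+ (suc m) n = ≈-trans (+-congˡ (natR-+ m n)) (≈-sym (+-assoc _ _ _))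

  cancel-inverse : ∀ {k kinv} → k * kinv ≈ 1# → ∀ a → k * (kinv * a) ≈ a
  cancel-inverse {k} {kinv} k*kinv≈1 a = begin
    k * (kinv * a)  ≈⟨ *-assoc k kinv a ⟨
    (k * kinv) * a  ≈⟨ *-congʳ k*kinv≈1 ⟩
    1# * a          ≈⟨ *-identityˡ a ⟩
    a               ∎

  solve-euler-relation : ∀ kinv s a → - s ≈ - 1# - kinv * - a → 1# - s ≈ kinv * a
  solve-euler-relation kinv s a eq = begin
    1# + - s                          ≈⟨ +-congˡ eq ⟩
    1# + (- 1# + - (kinv * - a))      ≈⟨ +-assoc 1# (- 1#) _ ⟨
    (1# + - 1#) + - (kinv * - a)      ≈⟨ +-congʳ (-‿inverseʳ 1#) ⟩
    0# + - (kinv * - a)               ≈⟨ +-identityˡ _ ⟩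
    - (kinv * - a)                    ≈⟨ -‿cong (-‿distribʳ-* kinv a) ⟨
    - - (kinv * a)                    ≈⟨ -‿involutive _ ⟩
    kinv * a                          ∎

  module _ {A : Set} (r : A → ℤ) where

    hasRank? : ∀ i → Decidable (λ z → r z ≡ + i)
    hasRank? i z = r z ℤ.≟ + i

    rankCount : List A → ℕ → ℕ
    rankCount zs i = length (filter (hasRank? i) zs)

    alternatingCount : List A → ℕ → S
    alternatingCount zs zero    = 0#
    alternatingCount zs (suc n) = alternatingCount zs n + sgn R n * natR R (rankCount zs (suc n))

    rankCount-∷ : ∀ z zs i → rankCount (z ∷ zs) i ≡ rankCount [ z ] i ℕ.+ rankCount zs i
    rankCount-∷ z zs i =
      trans (cong length (filter-++ (hasRank? i) [ z ] zs)) (length-++ (filter (hasRank? i) [ z ]))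

    alternatingCount-[] : ∀ n → alternatingCount [] n ≈ 0#
    alternatingCount-[] zero    = ≈-refl
    alternatingCount-[] (suc n) = ≈-trans (+-cong (alternatingCount-[] n) (zeroʳ _)) (+-identityʳ 0#)

    alternatingCount-∷ : ∀ z zs n → alternatingCount (z ∷ zs) n ≈
                                    alternatingCount [ z ] n + alternatingCount zs n
    alternatingCount-∷ z zs zero    = ≈-sym (+-identityˡ 0#)
    alternatingCount-∷ z zs (suc n) = begin
      alternatingCount (z ∷ zs) n + s * natR R (rankCount (z ∷ zs) (suc n))
        ≈⟨ +-cong (alternatingCount-∷ z zs n)
                  (*-congˡ (reflexive (cong (natR R) (rankCount-∷ z zs (suc n))))) ⟩
      (alternatingCount [ z ] n + alternatingCount zs n) + s * natR R (c₁ ℕ.+ c₂)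
        ≈⟨ +-congˡ (≈-trans (*-congˡ (natR-+ c₁ c₂)) (distribˡ s _ _)) ⟩
      (alternatingCount [ z ] n + alternatingCount zs n) + (s * natR R c₁ + s * natR R c₂)
        ≈⟨ interchange _ _ _ _ ⟩
      alternatingCount [ z ] (suc n) + alternatingCount zs (suc n) ∎
      where s  = sgn R n
            c₁ = rankCount [ z ] (suc n)
            c₂ = rankCount zs (suc n)

    alternatingCount-step-≢ : ∀ {z} n → r z ≢ + suc n →
                              sgn R n * natR R (rankCount [ z ] (suc n)) ≈ 0#
    alternatingCount-step-≢ n ρz≢ =
      ≈-trans (*-congˡ (reflexive (cong (natR R ∘ length) (filter-reject (hasRank? (suc n)) ρz≢))))
              (zeroʳ _)

    +suc-injective : ∀ {z i j} → r z ≡ + suc i → r z ≡ + suc j → i ≡ j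
    +suc-injective ρi ρj = ℕ.suc-injective (ℤ.+-injective (trans (sym ρi) ρj))

    alternatingCount-[]-outside : ∀ {z} n → (∀ {m} → m ℕ.< n → r z ≢ + suc m) →
                                  alternatingCount [ z ] n ≈ 0#
    alternatingCount-[]-outside zero    _      = ≈-refl
    alternatingCount-[]-outside (suc n) ρz≢ =
      ≈-trans (+-cong (alternatingCount-[]-outside n (ρz≢ ∘ ℕ.m<n⇒m<1+n))
                      (alternatingCount-step-≢ n (ρz≢ (ℕ.n<1+n n))))
              (+-identityʳ 0#)

    alternatingCount-[]-inside : ∀ {z m} n → r z ≡ + suc m → m ℕ.< n →
                                 alternatingCount [ z ] n ≈ sgn R m
    alternatingCount-[]-inside {z} {m} (suc n) ρz m<1+n
      with ℕ.m≤n⇒m<n∨m≡n (ℕ.≤-pred m<1+n)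
    ... | inj₁ m<n =
      ≈-trans (+-cong (alternatingCount-[]-inside n ρz m<n)
                      (alternatingCount-step-≢ n (ℕ.<⇒≢ m<n ∘ +suc-injective ρz)))
              (+-identityʳ _)
    ... | inj₂ refl = begin
      alternatingCount [ z ] m + sgn R m * natR R (rankCount [ z ] (suc m))
        ≈⟨ +-cong (alternatingCount-[]-outside m (λ i<m ρz′ → ℕ.<⇒≢ i<m (+suc-injective ρz′ ρz)))
                  (*-congˡ (reflexive (cong (natR R ∘ length) (filter-accept (hasRank? (suc m)) ρz)))) ⟩
      0# + sgn R m * (1# + 0#)
        ≈⟨ ≈-trans (+-identityˡ _) (≈-trans (*-congˡ (+-identityʳ 1#)) (*-identityʳ _)) ⟩
      sgn R m ∎

    sum-sgn-filter : ∀ {p} {B : Pred A p} (B? : Decidable B) n →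
                     (∀ {z} → B z → ∃[ m ] r z ≡ + suc m × m ℕ.< n) →
                     (∀ {z} → ¬ B z → ∀ {m} → m ℕ.< n → r z ≢ + suc m) →
                     ∀ zs → sumR R (map (sgn R ∘ ∣_∣ ∘ r) (filter B? zs)) ≈
                            - alternatingCount zs n
    sum-sgn-filter B? n inside outside [] =
      ≈-sym (≈-trans (-‿cong (alternatingCount-[] n)) -0#≈0#)
    sum-sgn-filter B? n inside outside (z ∷ zs) with B? z
    ... | no ¬Bz = begin
      sumR R (map (sgn R ∘ ∣_∣ ∘ r) (filter B? zs))
        ≈⟨ sum-sgn-filter B? n inside outside zs ⟩
      - alternatingCount zs n
        ≈⟨ -‿cong (+-identityˡ _) ⟨
      - (0# + alternatingCount zs n)
        ≈⟨ -‿cong (+-congʳ (alternatingCount-[]-outside n (outside ¬Bz))) ⟨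
      - (alternatingCount [ z ] n + alternatingCount zs n)
        ≈⟨ -‿cong (alternatingCount-∷ z zs n) ⟨
      - alternatingCount (z ∷ zs) n ∎
    ... | yes Bz with inside Bz
    ...   | m , ρz , m<n = begin
      sgn R ∣ r z ∣ + sumR R (map (sgn R ∘ ∣_∣ ∘ r) (filter B? zs))
        ≈⟨ +-cong (reflexive (cong (sgn R ∘ ∣_∣) ρz)) (sum-sgn-filter B? n inside outside zs) ⟩
      - sgn R m + - alternatingCount zs n
        ≈⟨ +-congʳ (-‿cong (alternatingCount-[]-inside n ρz m<n)) ⟨
      - alternatingCount [ z ] n + - alternatingCount zs n
        ≈⟨ -‿+-comm _ _ ⟩
      - (alternatingCount [ z ] n + alternatingCount zs n)
        ≈⟨ -‿cong (alternatingCount-∷ z zs n) ⟨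
      - alternatingCount (z ∷ zs) n ∎

  altSum-alternatingCount : ∀ P n → altSum R P n ≡ alternatingCount (rank P) (elements P) n
  altSum-alternatingCount P zero    = refl
  altSum-alternatingCount P (suc n) =
    cong (_+ sgn R n * natR R (f P (suc n))) (altSum-alternatingCount P n)

module MobiusProperties {c ℓ} (R : CommutativeRing c ℓ) (kinv : CommutativeRing.Carrier R)
                        (Q : GradedPoset) where
  open CommutativeRing R
    renaming (refl to ≈-refl; sym to ≈-sym; trans to ≈-trans)
  open RingSums R using (sumR-cong)
  open GradedPosetProperties Q
  open SetoidReasoning setoid
  private module Q = GradedPoset Q

  mu-budget-irrelevant : ∀ d e a b → length (Q.between a b) ℕ.< d →
                         length (Q.between a b) ℕ.< e → mu R kinv Q d a b ≈ mu R kinv Q e a b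
  mu-budget-irrelevant (suc d) (suc e) a b (s≤s p) (s≤s q) with a Q.≟ b
  ... | yes _ = ≈-refl
  ... | no _  = +-congˡ (-‿cong (*-congˡ (sumR-cong
        (All.map (λ (a<z , z<b) → let shrinks = length-between-<ˡ a<z z<b in
                   mu-budget-irrelevant d e a _ (ℕ.<-≤-trans shrinks p) (ℕ.<-≤-trans shrinks q))
                 (all-filter (strictlyBetween? a b) Q.elements)))))

  mu-stable : ∀ d a b → length (Q.between a b) ℕ.< d → mu R kinv Q d a b ≈ μk R kinv Q a b
  mu-stable d a b fits = mu-budget-irrelevant d _ a b fits (length-between-< a b)

  mu-suc-unfold : ∀ {a b} d → a ≢ b → mu R kinv Q (suc d) a b ≈
                                       - 1# - kinv * sumR R (map (mu R kinv Q d a) (Q.between a b))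
  mu-suc-unfold {a} {b} d a≢b with a Q.≟ b
  ... | yes a≡b = ⊥-elim (a≢b a≡b)
  ... | no _    = ≈-refl

  μk-unfold : ∀ {a b} → a ≢ b →
              μk R kinv Q a b ≈ - 1# - kinv * sumR R (map (μk R kinv Q a) (Q.between a b))
  μk-unfold {a} {b} a≢b = begin
    μk R kinv Q a b
      ≈⟨ mu-stable (suc m) a b (ℕ.n<1+n m) ⟨
    mu R kinv Q (suc m) a b
      ≈⟨ mu-suc-unfold m a≢b ⟩
    - 1# - kinv * sumR R (map (mu R kinv Q m a) (Q.between a b))
      ≈⟨ +-congˡ (-‿cong (*-congˡ (sumR-cong
           (All.map (λ (a<z , z<b) → mu-stable m a _ (length-between-<ˡ a<z z<b))
                    (all-filter (strictlyBetween? a b) Q.elements))))) ⟩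
    - 1# - kinv * sumR R (map (μk R kinv Q a) (Q.between a b)) ∎
    where m = length (Q.between a b)

module IntervalProperties (P : GradedPoset) (x y : Carrier P) (x≤y : T (_≤ᵇ_ P x y)) where
  open IntervalConstruction P x y x≤y using (I-ext; sub)
  open GradedPosetProperties using (StrictlyBetween; strictlyBetween?; length-between-<)
  private
    J = interval P x y x≤y
    module P = GradedPoset P
    module J = GradedPoset J

  inInterval? : Decidable (λ z → T (x P.≤ᵇ z) × T (z P.≤ᵇ y))
  inInterval? z = T? (x P.≤ᵇ z) ×-dec T? (z P.≤ᵇ y)

  map-proj₁-sub : ∀ zs → map proj₁ (sub zs) ≡ filter inInterval? zs
  map-proj₁-sub [] = refl
  map-proj₁-sub (z ∷ zs) with T? (x P.≤ᵇ z) | T? (z P.≤ᵇ y)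
  ... | yes x≤z | yes z≤y =
    trans (cong (z ∷_) (map-proj₁-sub zs)) (sym (filter-accept inInterval? (x≤z , z≤y)))
  ... | yes _   | no z≰y  =
    trans (map-proj₁-sub zs) (sym (filter-reject inInterval? (z≰y ∘ proj₂)))
  ... | no x≰z  | _       =
    trans (map-proj₁-sub zs) (sym (filter-reject inInterval? (x≰z ∘ proj₁)))

  interval-<⇔ : ∀ {a b} → (a J.< b) ⇔ (proj₁ a P.< proj₁ b)
  interval-<⇔ {a} {b} = mk⇔ (λ (a≤b , a≢b) → a≤b , a≢b ∘ I-ext a b)
                            (λ (a≤b , a≢b) → a≤b , a≢b ∘ cong proj₁)

  between-interval : ∀ a b → map proj₁ (J.between a b) ≡ P.between (proj₁ a) (proj₁ b)
  between-interval a b = begin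
    map proj₁ (filter (strictlyBetween? J a b) (sub P.elements))
      ≡⟨ cong (map proj₁) (filter-≐ (strictlyBetween? J a b) (strictlyBetween? P a₁ b₁ ∘ proj₁)
                             (strictlyBetween⁺ , strictlyBetween⁻) (sub P.elements)) ⟩
    map proj₁ (filter (strictlyBetween? P a₁ b₁ ∘ proj₁) (sub P.elements))
      ≡⟨ map-filter proj₁ (strictlyBetween? P a₁ b₁) (sub P.elements) ⟩
    filter (strictlyBetween? P a₁ b₁) (map proj₁ (sub P.elements))
      ≡⟨ cong (filter (strictlyBetween? P a₁ b₁)) (map-proj₁-sub P.elements) ⟩
    filter (strictlyBetween? P a₁ b₁) (filter inInterval? P.elements)
      ≡⟨ filter-absorbs (strictlyBetween? P a₁ b₁) inInterval? inside P.elements ⟩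
    P.between a₁ b₁ ∎
    where
    open ≡-Reasoning
    open Equivalence using (to; from)
    a₁ = proj₁ a
    b₁ = proj₁ b
    strictlyBetween⁺ : ∀ {w} → StrictlyBetween J a b w → StrictlyBetween P a₁ b₁ (proj₁ w)
    strictlyBetween⁺ (a<w , w<b) = to interval-<⇔ a<w , to interval-<⇔ w<b
    strictlyBetween⁻ : ∀ {w} → StrictlyBetween P a₁ b₁ (proj₁ w) → StrictlyBetween J a b w
    strictlyBetween⁻ (a<w , w<b) = from interval-<⇔ a<w , from interval-<⇔ w<b
    inside : ∀ {w} → StrictlyBetween P a₁ b₁ w → T (x P.≤ᵇ w) × T (w P.≤ᵇ y)
    inside {w} ((a≤w , _) , (w≤b , _)) =
      P.≤-trans x a₁ w (proj₁ (proj₂ a)) a≤w , P.≤-trans w b₁ y w≤b (proj₂ (proj₂ b))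

  rank-difference-interval : ∀ a b →
                             J.rank b ℤ.- J.rank a ≡ P.rank (proj₁ b) ℤ.- P.rank (proj₁ a)
  rank-difference-interval a b =
    solve 3 (λ β α ξ → (β :- ξ) :- (α :- ξ) := β :- α) refl
      (P.rank (proj₁ b)) (P.rank (proj₁ a)) (P.rank x)
    where open +-*-Solver

  module _ {c ℓ} (R : CommutativeRing c ℓ) (kinv : CommutativeRing.Carrier R) where
    open CommutativeRing R
      renaming (refl to ≈-refl; sym to ≈-sym; trans to ≈-trans)
    open RingSums R using (sumR-cong)
    open SetoidReasoning setoid

    mu-interval : ∀ d a b → mu R kinv J d a b ≈ mu R kinv P d (proj₁ a) (proj₁ b)
    mu-interval zero a b = ≈-refl
    mu-interval (suc d) a b with a J.≟ b | proj₁ a P.≟ proj₁ b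
    ... | yes _   | yes _   = ≈-refl
    ... | yes a≡b | no a≢b  = ⊥-elim (a≢b (cong proj₁ a≡b))
    ... | no a≢b  | yes a≡b = ⊥-elim (a≢b (I-ext a b a≡b))
    ... | no _    | no _    = +-congˡ (-‿cong (*-congˡ (begin
      sumR R (map (mu R kinv J d a) (J.between a b))
        ≈⟨ sumR-cong (All.universal (mu-interval d a) (J.between a b)) ⟩
      sumR R (map (mu R kinv P d (proj₁ a) ∘ proj₁) (J.between a b))
        ≡⟨ cong (sumR R) (map-∘ (J.between a b)) ⟩
      sumR R (map (mu R kinv P d (proj₁ a)) (map proj₁ (J.between a b)))
        ≡⟨ cong (sumR R ∘ map (mu R kinv P d (proj₁ a))) (between-interval a b) ⟩
      sumR R (map (mu R kinv P d (proj₁ a)) (P.between (proj₁ a) (proj₁ b))) ∎)))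

    interval-isKEulerian : IsKEulerian R kinv P → IsKEulerian R kinv J
    interval-isKEulerian E a b a≤b = begin
      μk R kinv J a b
        ≈⟨ mu-interval (length J.elements) a b ⟩
      mu R kinv P (length J.elements) (proj₁ a) (proj₁ b)
        ≈⟨ MobiusProperties.mu-stable R kinv P _ (proj₁ a) (proj₁ b) fits ⟩
      μk R kinv P (proj₁ a) (proj₁ b)
        ≈⟨ E (proj₁ a) (proj₁ b) a≤b ⟩
      sgn R ∣ P.rank (proj₁ b) ℤ.- P.rank (proj₁ a) ∣
        ≡⟨ cong (sgn R ∘ ∣_∣) (rank-difference-interval a b) ⟨
      sgn R ∣ J.rank b ℤ.- J.rank a ∣ ∎
      where
      fits : length (P.between (proj₁ a) (proj₁ b)) ℕ.< length J.elements
      fits = subst (ℕ._< length J.elements)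
               (trans (sym (length-map proj₁ (J.between a b))) (cong length (between-interval a b)))
               (length-between-< J a b)

module EulerRelation {c ℓ} (R : CommutativeRing c ℓ) (kinv : CommutativeRing.Carrier R)
                     (P : GradedPoset) (n : ℕ) (ρ-top : rank P (top P) ≡ + suc n)
                     (E : IsKEulerian R kinv P) where
  open CommutativeRing R
    renaming (refl to ≈-refl; sym to ≈-sym; trans to ≈-trans)
  open RingSums R
  open GradedPosetProperties P
  open MobiusProperties R kinv P using (μk-unfold)
  open SetoidReasoning setoid
  private module P = GradedPoset P

  bot≢top : P.bot ≢ P.top
  bot≢top bot≡top =
    ℕ.1+n≢0 (ℤ.+-injective (trans (sym ρ-top) (trans (cong P.rank (sym bot≡top)) P.rank-bot)))

  rank-strictlyBetween : ∀ {z} → StrictlyBetween P.bot P.top z →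
                         ∃[ m ] P.rank z ≡ + suc m × m ℕ.< n
  rank-strictlyBetween (bot<z , z<top) with rank-increasing bot<z | rank-increasing z<top
  ... | i , ρz | j , ρtop = i , ρz′ , subst (i ℕ.<_) (sym n≡i+1+j) (ℕ.m<m+n i (s≤s ℕ.z≤n))
    where
    ρz′ = trans ρz (cong (ℤ._+ + suc i) P.rank-bot)
    n≡i+1+j = ℕ.suc-injective (ℤ.+-injective
                (trans (sym ρ-top) (trans ρtop (cong (ℤ._+ + suc j) ρz′))))

  rank-not-strictlyBetween : ∀ {z} → ¬ StrictlyBetween P.bot P.top z →
                             ∀ {m} → m ℕ.< n → P.rank z ≢ + suc m
  rank-not-strictlyBetween {z} ¬bot<z<top m<n ρz with z P.≟ P.bot | z P.≟ P.top
  ... | yes refl | _        = ℕ.1+n≢0 (ℤ.+-injective (trans (sym ρz) P.rank-bot))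
  ... | no _     | yes refl = ℕ.<⇒≢ m<n (ℕ.suc-injective (ℤ.+-injective (trans (sym ρz) ρ-top)))
  ... | no z≢bot | no z≢top =
    ¬bot<z<top ((P.bot-least z , z≢bot ∘ sym) , (P.top-greatest z , z≢top))

  μk-bot : ∀ z → μk R kinv P P.bot z ≈ sgn R ∣ P.rank z ∣
  μk-bot z = ≈-trans (E P.bot z (P.bot-least z)) (reflexive (cong (sgn R ∘ ∣_∣) ρz-ρbot≡ρz))
    where
    ρz-ρbot≡ρz : P.rank z ℤ.- P.rank P.bot ≡ P.rank z
    ρz-ρbot≡ρz = trans (cong (λ ρ₀ → P.rank z ℤ.- ρ₀) P.rank-bot) (ℤ.+-identityʳ (P.rank z))

  sum-μk-bot : sumR R (map (μk R kinv P P.bot) (P.between P.bot P.top)) ≈ - altSum R P n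
  sum-μk-bot = begin
    sumR R (map (μk R kinv P P.bot) (P.between P.bot P.top))
      ≈⟨ sumR-cong (All.universal μk-bot (P.between P.bot P.top)) ⟩
    sumR R (map (sgn R ∘ ∣_∣ ∘ P.rank) (P.between P.bot P.top))
      ≈⟨ sum-sgn-filter P.rank (strictlyBetween? P.bot P.top) n
           rank-strictlyBetween rank-not-strictlyBetween P.elements ⟩
    - alternatingCount P.rank P.elements n
      ≡⟨ cong -_ (altSum-alternatingCount P n) ⟨
    - altSum R P n ∎

  euler-relation : 1# - sgn R n ≈ kinv * altSum R P n
  euler-relation = solve-euler-relation kinv (sgn R n) (altSum R P n) (begin
    sgn R (suc n)
      ≡⟨ cong (sgn R ∘ ∣_∣) ρ-top ⟨
    sgn R ∣ P.rank P.top ∣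
      ≈⟨ μk-bot P.top ⟨
    μk R kinv P P.bot P.top
      ≈⟨ μk-unfold bot≢top ⟩
    - 1# - kinv * sumR R (map (μk R kinv P P.bot) (P.between P.bot P.top))
      ≈⟨ +-congˡ (-‿cong (*-congˡ sum-μk-bot)) ⟩
    - 1# - kinv * - altSum R P n ∎)

mainTheorem4 : {c ℓ : Level} (R : CommutativeRing c ℓ)
               (k kinv : CommutativeRing.Carrier R) →
               CommutativeRing._≈_ R (CommutativeRing._*_ R k kinv) (CommutativeRing.1# R) →
               (P : GradedPoset) (n : ℕ) →
               rank P (top P) ≡ + suc n →
               IsKEulerian R kinv P →
               ((x y : Carrier P) (x≤y : T (_≤ᵇ_ P x y)) →
                  IsKEulerian R kinv (interval P x y x≤y))
               × CommutativeRing._≈_ R (altSum R P n)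
                   (CommutativeRing._*_ R k
                     (CommutativeRing._-_ R (CommutativeRing.1# R) (sgn R n)))
mainTheorem4 R k kinv k*kinv≈1 P n ρ-top E =
  (λ x y x≤y → IntervalProperties.interval-isKEulerian P x y x≤y R kinv E) ,
  (begin
    altSum R P n                 ≈⟨ cancel-inverse k*kinv≈1 (altSum R P n) ⟨
    k * (kinv * altSum R P n)    ≈⟨ *-congˡ (EulerRelation.euler-relation R kinv P n ρ-top E) ⟨
    k * (1# - sgn R n)           ∎)
  where
  open CommutativeRing R
  open RingSums R using (cancel-inverse)
  open SetoidReasoning setoid
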